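{- Let $I$ be a finite set and $P\vDash I$ a composition of $I$. Then $\sum_{Q\prec P} (-1)^{l(Q)} = (-1)^{|I|}$. More generally, let $G$ be a directed acyclic graph on vertex set $I$ (a set of ordered pairs $(v,v')$ of elements of $I$ with no directed cycle) and let $C(G,P)=\{Q\prec P\,:\, Q(v)< Q(v') \text{ for all } (v,v')\in G\}$. Then $$\sum_{Q\in C(G,P)} (-1)^{l(Q)} = \begin{cases} 0 & \text{if there exists } (v,v')\in G \text{ with } P(v')<P(v),\\ (-1)^{|I|} & \text{otherwise.}\end{cases}$$
   Context: A composition of a finite set $I$ is a sequence $P=(P_1,\dots,P_l)$ of nonempty pairwise disjoint subsets with union $I$; $l(P)=l$ is its length; for $v\in I$, $P(v)$ is the index $i$ with $v\in P_i$. A composition $Q$ refines $P$ ($Q\prec P$) if $Q=(P_{1,1},\dots,P_{1,k_1},P_{2,1},\dots,P_{l,k_l})$ with $P_i=\bigcup_{j=1}^{k_i}P_{i,j}$ for each $i$. -}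

module Defs where

open import Data.Nat using (ℕ; zero; suc; _<_)
open import Data.Integer using (ℤ; _+_; -1ℤ; 0ℤ; _^_)
open import Data.Fin using (Fin)
open import Data.Fin.Subset using (Subset; ⋃; ⊤; ⊥; _∩_; Nonempty) renaming (_∈_ to _∈ₛ_)
open import Data.Fin.Subset.Properties using (_∈?_)
open import Data.List using (List; []; _∷_; concat; length; foldr)
open import Data.List.Relation.Unary.All using (All)
open import Data.List.Relation.Unary.AllPairs using (AllPairs)
open import Data.List.Relation.Binary.Pointwise using (Pointwise)
open import Data.List.Membership.Propositional using (_∈_)
open import Data.Product using (_×_; Σ; ∃; _,_)
open import Relation.Nullary using (¬_; yes; no)
open import Relation.Binary.PropositionalEquality using (_≡_)

-- The finite set I is modelled as Fin n.
-- A candidate composition is a list of subsets (P₁,…,Pₗ).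
IsComposition : ∀ {n} → List (Subset n) → Set
IsComposition P =
  All Nonempty P × AllPairs (λ A B → A ∩ B ≡ ⊥) P × ⋃ P ≡ ⊤

len : ∀ {n} → List (Subset n) → ℕ
len = length

-- P(v): the (0-based) index of the block containing v
-- (for a composition there is exactly one such block).
blockIndex : ∀ {n} → List (Subset n) → Fin n → ℕ
blockIndex [] v = zero
blockIndex (S ∷ P) v with v ∈? S
... | yes _ = zero
... | no  _ = suc (blockIndex P v)

_≺_ : ∀ {n} → List (Subset n) → List (Subset n) → Set
Q ≺ P = Σ (List (List (Subset _))) λ Ls →
          Pointwise (λ Qi Pi → ⋃ Qi ≡ Pi) Ls P × concat Ls ≡ Q

Graph : ℕ → Set
Graph n = List (Fin n × Fin n)

data Path⁺ {n} (G : Graph n) : Fin n → Fin n → Set where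
  edge : ∀ {u v} → (u , v) ∈ G → Path⁺ G u v
  _▸_  : ∀ {u v w} → Path⁺ G u v → Path⁺ G v w → Path⁺ G u w

Acyclic : ∀ {n} → Graph n → Set
Acyclic G = ∀ v → ¬ Path⁺ G v v

InC : ∀ {n} → Graph n → List (Subset n) → List (Subset n) → Set
InC G P Q = IsComposition Q × Q ≺ P ×
  (∀ {v v'} → (v , v') ∈ G → blockIndex Q v < blockIndex Q v')

sgn : ℕ → ℤ
sgn k = -1ℤ ^ k

signedSum : ∀ {n} → List (List (Subset n)) → ℤ
signedSum = foldr (λ Q acc → sgn (len Q) + acc) 0ℤ

-- Induct on |⋃ P|, splitting off the first block. For P = (p, P₀), the first block b of any Q ∈ C(G,P) is a
-- nonempty set of sources of G inside p (elements without a G-predecessor in ⋃ P), and the rest of Q lies in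
-- C(G,P') where P' is P with b removed from p; conversely every such b and every element of C(G,P') give an
-- element of C(G,P). So Σ_{Q ∈ C(G,P)} (-1)^l(Q) = Σ_b -(-1)^(|⋃ P| - |b|) = -(-1)^|⋃ P| Σ_b (-1)^|b| = (-1)^|⋃ P|,
-- because the signs of the nonempty subsets of a nonempty set sum to -1, and the set of sources is nonempty: an
-- acyclic graph without back edge in P cannot have every element of p preceded by another one. If an edge goes
-- backwards in P, no refinement can put it forwards, so C(G,P) is empty. The first claim is the case G = ∅.

module Submission where

open import Algebra.Properties.CommutativeSemigroup using (x∙yz≈y∙xz)
open import Data.Bool using (true; false)
open import Data.Bool.Properties using (T-≡)
open import Data.Empty using (⊥-elim) renaming (⊥ to False)
open import Data.Fin using (Fin; zero; suc; toℕ)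
import Data.Fin as Fin
open import Data.Fin.Properties using (pigeonhole; any?) renaming (_≟_ to _≟ᶠ_)
open import Data.Fin.Subset using (Subset; ⋃; ⊤; ⊥; _∩_; _∪_; _─_; Nonempty; Empty; ∣_∣; _⊆_)
  renaming (_∈_ to _∈ₛ_; _∉_ to _∉ₛ_)
open import Data.Fin.Subset.Properties using (_∈?_; ∈⊤; ∉⊥; ⊥⊆; ⊆-antisym; x∈p∩q⁺; x∈p∩q⁻; x∈p∪q⁺; x∈p∪q⁻;
  x∈p∧x∉q⇒x∈p─q; p─q⊆p; nonempty?; ∪-assoc; ∪-identityˡ; ∪-identityʳ; drop-∷-⊆; Empty-unique; ∣⊥∣≡0; ∣⊤∣≡n;
  p⊆q⇒∣p∣≤∣q∣; ∣⁅x⁆∣≡1; x∈⁅y⁆⇒x≡y)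
open import Data.Integer using (ℤ; _+_; _*_; -_; 0ℤ; 1ℤ; -1ℤ)
import Data.Integer.Properties as ℤ
open import Data.Integer.Tactic.RingSolver using (solve-∀)
open import Data.List using (List; []; _∷_; _++_; map; foldr; length; concat)
open import Data.List.Properties using (∷-injectiveʳ)
open import Data.List.Membership.Propositional using (_∈_)
open import Data.List.Membership.Propositional.Properties using (∈-++⁻; ∈-++⁺ˡ; ∈-++⁺ʳ; ∈-map⁻; ∈-map⁺)
open import Data.List.Membership.Propositional.Properties.WithK using (unique∧set⇒bag)
open import Data.List.Relation.Binary.BagAndSetEquality using (∼bag⇒↭)
open import Data.List.Relation.Binary.Permutation.Propositional using (_↭_; refl; prep; swap; trans)
open import Data.List.Relation.Binary.Pointwise using (Pointwise; []; _∷_)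
open import Data.List.Relation.Unary.All as All using (All; []; _∷_)
open import Data.List.Relation.Unary.All.Properties using (All¬⇒¬Any)
open import Data.List.Relation.Unary.AllPairs using (AllPairs; []; _∷_)
open import Data.List.Relation.Unary.Any using (here; there)
open import Data.List.Relation.Unary.Unique.Propositional using (Unique)
import Data.List.Relation.Unary.Unique.Propositional.Properties as Unique
open import Data.Nat using (ℕ; _<_)
import Data.Nat as ℕ
import Data.Nat.Properties as ℕ
open import Data.Product using (_×_; Σ; ∃; ∃₂; _,_; proj₁; proj₂)
open import Data.Product.Properties using (≡-dec)
open import Data.Sum using (inj₁; inj₂; [_,_]′)
open import Data.Vec using ([]; _∷_; here; there; tabulate)
import Data.Vec.Properties as Vec
open import Function using (_∘_)
open import Function.Bundles using (_⇔_; mk⇔; Equivalence)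
import Function.Properties.Equivalence as ⇔
open import Relation.Binary.PropositionalEquality using (_≡_; _≢_; refl; sym; cong; cong₂; module ≡-Reasoning)
import Relation.Binary.PropositionalEquality as ≡
open import Relation.Nullary using (¬_; yes; no; Dec)
open import Relation.Nullary.Decidable using (_×-dec_; ¬?; isYes; toWitness; fromWitness)

open import Defs

-- Signed sums over lists

module _ {a} {A : Set a} where

  sumBy : (A → ℤ) → List A → ℤ
  sumBy f = foldr (λ x s → f x + s) 0ℤ

  sumBy-++ : ∀ f xs ys → sumBy f (xs ++ ys) ≡ sumBy f xs + sumBy f ys
  sumBy-++ f [] ys = sym (ℤ.+-identityˡ _)
  sumBy-++ f (x ∷ xs) ys = ≡.trans (cong (f x +_) (sumBy-++ f xs ys)) (sym (ℤ.+-assoc (f x) _ _))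

  sumBy-↭ : ∀ f {xs ys} → xs ↭ ys → sumBy f xs ≡ sumBy f ys
  sumBy-↭ f refl = refl
  sumBy-↭ f (prep x p) = cong (f x +_) (sumBy-↭ f p)
  sumBy-↭ f (swap x y p) =
    ≡.trans (cong (λ s → f x + (f y + s)) (sumBy-↭ f p)) (x∙yz≈y∙xz ℤ.+-commutativeSemigroup (f x) (f y) _)
  sumBy-↭ f (trans p q) = ≡.trans (sumBy-↭ f p) (sumBy-↭ f q)

  sumBy-unique : ∀ f {xs ys} → Unique xs → Unique ys → (∀ {x} → x ∈ xs ⇔ x ∈ ys) →
                 sumBy f xs ≡ sumBy f ys
  sumBy-unique f u v xs⇔ys = sumBy-↭ f (∼bag⇒↭ (unique∧set⇒bag u v xs⇔ys))

  sumBy-neg-*ʳ : ∀ f c xs → sumBy (λ x → - (f x * c)) xs ≡ - (sumBy f xs * c)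
  sumBy-neg-*ʳ f c [] = cong -_ (sym (ℤ.*-zeroˡ c))
  sumBy-neg-*ʳ f c (x ∷ xs) = ≡.trans (cong (- (f x * c) +_) (sumBy-neg-*ʳ f c xs)) (distrib (f x) (sumBy f xs) c)
    where
    distrib : ∀ a s c → - (a * c) + - (s * c) ≡ - ((a + s) * c)
    distrib = solve-∀

sgn-suc : ∀ k → sgn (ℕ.suc k) ≡ - sgn k
sgn-suc k = ℤ.-1*i≡-i (sgn k)

sgn-+-cancel : ∀ a b → sgn a * sgn (a ℕ.+ b) ≡ sgn b
sgn-+-cancel ℕ.zero b = ℤ.*-identityˡ (sgn b)
sgn-+-cancel (ℕ.suc a) b = ≡.trans (neg*neg (sgn a) (sgn (a ℕ.+ b))) (sgn-+-cancel a b)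
  where
  neg*neg : ∀ x y → (-1ℤ * x) * (-1ℤ * y) ≡ x * y
  neg*neg = solve-∀

module _ {A : Set} where

  Enumerates : List A → (A → Set) → Set
  Enumerates xs C = Unique xs × (∀ x → x ∈ xs ⇔ C x)

  enumerates-⇔ : ∀ {xs C D} → Enumerates xs C → (∀ x → C x ⇔ D x) → Enumerates xs D
  enumerates-⇔ (u , xs⇔C) C⇔D = u , λ x → ⇔.trans (xs⇔C x) (C⇔D x)

  sumBy-enumerates : ∀ f {xs ys C} → Enumerates xs C → Enumerates ys C → sumBy f xs ≡ sumBy f ys
  sumBy-enumerates f (u , xs⇔C) (v , ys⇔C) = sumBy-unique f u v (λ {x} → ⇔.trans (xs⇔C x) (⇔.sym (ys⇔C x)))

  enumerates-∅ : ∀ {xs C} → Enumerates xs C → (∀ x → ¬ C x) → xs ≡ []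
  enumerates-∅ {[]} _ _ = refl
  enumerates-∅ {x ∷ _} (_ , xs⇔C) ∄C = ⊥-elim (∄C x (Equivalence.to (xs⇔C x) (here refl)))

module _ {A : Set} where

  -- At A = Subset n this is signedSum, definitionally.
  signedCount : List (List A) → ℤ
  signedCount = sumBy (sgn ∘ length)

  signedCount-map-∷ : ∀ b xss → signedCount (map (b ∷_) xss) ≡ - signedCount xss
  signedCount-map-∷ b [] = refl
  signedCount-map-∷ b (xs ∷ xss) = begin
    sgn (ℕ.suc (length xs)) + signedCount (map (b ∷_) xss)
      ≡⟨ cong₂ _+_ (sgn-suc (length xs)) (signedCount-map-∷ b xss) ⟩
    - sgn (length xs) + - signedCount xss
      ≡⟨ ℤ.neg-distrib-+ (sgn (length xs)) _ ⟨
    - signedCount (xs ∷ xss)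
      ∎
    where open ≡-Reasoning

  ConsOf : List A → (A → List A → Set) → List A → Set
  ConsOf bs D xs = Σ A λ b → Σ (List A) λ ys → xs ≡ b ∷ ys × b ∈ bs × D b ys

  enumerate-ConsOf : ∀ {bs} (D : A → List A → Set) (w : A → ℤ) → Unique bs →
    All (λ b → Σ (List (List A)) λ yss → Enumerates yss (D b) × signedCount yss ≡ w b) bs →
    Σ (List (List A)) λ xss → Enumerates xss (ConsOf bs D) × signedCount xss ≡ sumBy (-_ ∘ w) bs
  enumerate-ConsOf D w [] [] = [] , ([] , λ xs → mk⇔ (λ ()) λ { (_ , _ , _ , () , _) }) , refl
  enumerate-ConsOf {b ∷ bs} D w (b∉bs ∷ u) ((yss , (uy , yss⇔) , Σyss) ∷ rest)
    with enumerate-ConsOf D w u rest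
  ... | zss , (uz , zss⇔) , Σzss =
    map (b ∷_) yss ++ zss ,
    (Unique.++⁺ (Unique.map⁺ {f = b ∷_} ∷-injectiveʳ uy) uz disjoint , λ xs → mk⇔ to from) ,
    (begin
      signedCount (map (b ∷_) yss ++ zss)             ≡⟨ sumBy-++ (sgn ∘ length) (map (b ∷_) yss) zss ⟩
      signedCount (map (b ∷_) yss) + signedCount zss  ≡⟨ cong₂ _+_ (signedCount-map-∷ b yss) Σzss ⟩
      - signedCount yss + sumBy (-_ ∘ w) bs           ≡⟨ cong (λ s → - s + _) Σyss ⟩
      - w b + sumBy (-_ ∘ w) bs                       ∎)
    where
    open ≡-Reasoning
    disjoint : ∀ {xs} → ¬ (xs ∈ map (b ∷_) yss × xs ∈ zss)
    disjoint (p , q) with ∈-map⁻ (b ∷_) p | Equivalence.to (zss⇔ _) q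
    ... | _ , _ , refl | _ , _ , refl , b∈bs , _ = All¬⇒¬Any b∉bs b∈bs
    to : ∀ {xs} → xs ∈ map (b ∷_) yss ++ zss → ConsOf (b ∷ bs) D xs
    to p with ∈-++⁻ (map (b ∷_) yss) p
    ... | inj₁ q with ∈-map⁻ (b ∷_) q
    ... | ys , ys∈ , refl = b , ys , refl , here refl , Equivalence.to (yss⇔ ys) ys∈
    to p | inj₂ q with Equivalence.to (zss⇔ _) q
    ... | c , ys , eq , c∈bs , d = c , ys , eq , there c∈bs , d
    from : ∀ {xs} → ConsOf (b ∷ bs) D xs → xs ∈ map (b ∷_) yss ++ zss
    from (_ , ys , refl , here refl , d) = ∈-++⁺ˡ (∈-map⁺ (b ∷_) (Equivalence.from (yss⇔ ys) d))
    from (c , ys , eq , there c∈bs , d) = ∈-++⁺ʳ (map (b ∷_) yss) (Equivalence.from (zss⇔ _) (c , ys , eq , c∈bs , d))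

-- Subsets of Fin n

∩≡⊥⇒∉ : ∀ {n} {p q : Subset n} {x} → p ∩ q ≡ ⊥ → x ∈ₛ p → x ∉ₛ q
∩≡⊥⇒∉ {x = x} p∩q≡⊥ x∈p x∈q = ∉⊥ (≡.subst (x ∈ₛ_) p∩q≡⊥ (x∈p∩q⁺ (x∈p , x∈q)))

∉⇒∩≡⊥ : ∀ {n} {p q : Subset n} → (∀ {x} → x ∈ₛ p → x ∉ₛ q) → p ∩ q ≡ ⊥
∉⇒∩≡⊥ {p = p} {q} p∌q = ⊆-antisym (λ x∈p∩q → let x∈p , x∈q = x∈p∩q⁻ p q x∈p∩q in ⊥-elim (p∌q x∈p x∈q)) ⊥⊆

x∈p─q⇒x∉q : ∀ {n} {p q : Subset n} {x} → x ∈ₛ p ─ q → x ∉ₛ q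
x∈p─q⇒x∉q {p = true ∷ p} {false ∷ q} here ()
x∈p─q⇒x∉q {p = _ ∷ p} {_ ∷ q} (there x∈p─q) (there x∈q) = x∈p─q⇒x∉q x∈p─q x∈q

x∈⋃⁺ : ∀ {n} {ps : List (Subset n)} {p x} → p ∈ ps → x ∈ₛ p → x ∈ₛ ⋃ ps
x∈⋃⁺ (here refl) x∈p = x∈p∪q⁺ (inj₁ x∈p)
x∈⋃⁺ (there p∈ps) x∈p = x∈p∪q⁺ (inj₂ (x∈⋃⁺ p∈ps x∈p))

x∈⋃⁻ : ∀ {n} (ps : List (Subset n)) {x} → x ∈ₛ ⋃ ps → ∃ λ p → p ∈ ps × x ∈ₛ p
x∈⋃⁻ [] x∈⊥ = ⊥-elim (∉⊥ x∈⊥)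
x∈⋃⁻ (p ∷ ps) x∈⋃ with x∈p∪q⁻ p (⋃ ps) x∈⋃
... | inj₁ x∈p = p , here refl , x∈p
... | inj₂ x∈⋃ps with x∈⋃⁻ ps x∈⋃ps
... | q , q∈ps , x∈q = q , there q∈ps , x∈q

⋃-++ : ∀ {n} (ps qs : List (Subset n)) → ⋃ (ps ++ qs) ≡ ⋃ ps ∪ ⋃ qs
⋃-++ [] qs = sym (∪-identityˡ _)
⋃-++ (p ∷ ps) qs = ≡.trans (cong (p ∪_) (⋃-++ ps qs)) (sym (∪-assoc p _ _))

∣p∣≡∣q∣+∣p─q∣ : ∀ {n} (p q : Subset n) → q ⊆ p → ∣ p ∣ ≡ ∣ q ∣ ℕ.+ ∣ p ─ q ∣
∣p∣≡∣q∣+∣p─q∣ [] [] _ = refl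
∣p∣≡∣q∣+∣p─q∣ (true ∷ p) (true ∷ q) q⊆p = cong ℕ.suc (∣p∣≡∣q∣+∣p─q∣ p q (drop-∷-⊆ q⊆p))
∣p∣≡∣q∣+∣p─q∣ (true ∷ p) (false ∷ q) q⊆p =
  ≡.trans (cong ℕ.suc (∣p∣≡∣q∣+∣p─q∣ p q (drop-∷-⊆ q⊆p))) (sym (ℕ.+-suc _ _))
∣p∣≡∣q∣+∣p─q∣ (false ∷ p) (false ∷ q) q⊆p = ∣p∣≡∣q∣+∣p─q∣ p q (drop-∷-⊆ q⊆p)
∣p∣≡∣q∣+∣p─q∣ (false ∷ p) (true ∷ q) q⊆p with q⊆p here
... | ()

p⊆q∪[p─q] : ∀ {n} (p q : Subset n) → p ⊆ q ∪ (p ─ q)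
p⊆q∪[p─q] p q {x} x∈p with x ∈? q
... | yes x∈q = x∈p∪q⁺ (inj₁ x∈q)
... | no x∉q = x∈p∪q⁺ (inj₂ (x∈p∧x∉q⇒x∈p─q x∈p x∉q))

Nonempty⇒∣p∣>0 : ∀ {n} {p : Subset n} → Nonempty p → 0 < ∣ p ∣
Nonempty⇒∣p∣>0 {p = p} (x , x∈p) =
  ≡.subst (ℕ._≤ ∣ p ∣) (∣⁅x⁆∣≡1 x) (p⊆q⇒∣p∣≤∣q∣ (λ y∈⁅x⁆ → ≡.subst (_∈ₛ p) (sym (x∈⁅y⁆⇒x≡y x y∈⁅x⁆)) x∈p))

sgn∣∣ : ∀ {n} → Subset n → ℤ
sgn∣∣ = sgn ∘ ∣_∣

sumBy-map-false : ∀ {n} (qs : List (Subset n)) → sumBy sgn∣∣ (map (false ∷_) qs) ≡ sumBy sgn∣∣ qs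
sumBy-map-false [] = refl
sumBy-map-false (q ∷ qs) = cong (sgn ∣ q ∣ +_) (sumBy-map-false qs)

sumBy-map-true : ∀ {n} (qs : List (Subset n)) → sumBy sgn∣∣ (map (true ∷_) qs) ≡ - sumBy sgn∣∣ qs
sumBy-map-true [] = refl
sumBy-map-true (q ∷ qs) =
  ≡.trans (cong₂ _+_ (sgn-suc ∣ q ∣) (sumBy-map-true qs)) (sym (ℤ.neg-distrib-+ (sgn ∣ q ∣) _))

nonemptySubsets : ∀ {n} → Subset n → List (Subset n)
nonemptySubsets [] = []
nonemptySubsets (false ∷ p) = map (false ∷_) (nonemptySubsets p)
nonemptySubsets (true ∷ p) = map (false ∷_) (nonemptySubsets p) ++ map (true ∷_) (⊥ ∷ nonemptySubsets p)

∈-nonemptySubsets⁻ : ∀ {n} (p : Subset n) {q} → q ∈ nonemptySubsets p → Nonempty q × q ⊆ p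
∈-nonemptySubsets⁻ [] ()
∈-nonemptySubsets⁻ (false ∷ p) q∈ with ∈-map⁻ (false ∷_) q∈
... | q , q∈′ , refl = suc-nonempty (∈-nonemptySubsets⁻ p q∈′)
  where
  suc-nonempty : ∀ {q} → Nonempty q × q ⊆ p → Nonempty (false ∷ q) × (false ∷ q) ⊆ (false ∷ p)
  suc-nonempty ((x , x∈q) , q⊆p) = (suc x , there x∈q) , λ { (there y∈q) → there (q⊆p y∈q) }
∈-nonemptySubsets⁻ (true ∷ p) q∈ with ∈-++⁻ (map (false ∷_) (nonemptySubsets p)) q∈
... | inj₁ q∈ˡ with ∈-map⁻ (false ∷_) q∈ˡ
... | q , q∈′ , refl with ∈-nonemptySubsets⁻ p q∈′
... | (x , x∈q) , q⊆p = (suc x , there x∈q) , λ { (there y∈q) → there (q⊆p y∈q) }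
∈-nonemptySubsets⁻ (true ∷ p) q∈ | inj₂ q∈ʳ with ∈-map⁻ (true ∷_) q∈ʳ
... | q , here refl , refl = (zero , here) , λ { here → here ; (there y∈⊥) → ⊥-elim (∉⊥ y∈⊥) }
... | q , there q∈′ , refl with ∈-nonemptySubsets⁻ p q∈′
... | _ , q⊆p = (zero , here) , λ { here → here ; (there y∈q) → there (q⊆p y∈q) }

∈-nonemptySubsets⁺ : ∀ {n} (p q : Subset n) → Nonempty q → q ⊆ p → q ∈ nonemptySubsets p
∈-nonemptySubsets⁺ [] [] (() , _) _
∈-nonemptySubsets⁺ (_ ∷ p) (false ∷ q) (zero , ()) q⊆p
∈-nonemptySubsets⁺ (false ∷ p) (false ∷ q) (suc x , there x∈q) q⊆p =
  ∈-map⁺ (false ∷_) (∈-nonemptySubsets⁺ p q (x , x∈q) (drop-∷-⊆ q⊆p))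
∈-nonemptySubsets⁺ (true ∷ p) (false ∷ q) (suc x , there x∈q) q⊆p =
  ∈-++⁺ˡ (∈-map⁺ (false ∷_) (∈-nonemptySubsets⁺ p q (x , x∈q) (drop-∷-⊆ q⊆p)))
∈-nonemptySubsets⁺ (false ∷ p) (true ∷ q) _ q⊆p with q⊆p here
... | ()
∈-nonemptySubsets⁺ (true ∷ p) (true ∷ q) _ q⊆p =
  ∈-++⁺ʳ (map (false ∷_) (nonemptySubsets p)) (∈-map⁺ (true ∷_) tail∈)
  where
  tail∈ : q ∈ ⊥ ∷ nonemptySubsets p
  tail∈ with nonempty? q
  ... | yes q≢∅ = there (∈-nonemptySubsets⁺ p q q≢∅ (drop-∷-⊆ q⊆p))
  ... | no q≡∅ = here (Empty-unique q≡∅)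

nonemptySubsets-unique : ∀ {n} (p : Subset n) → Unique (nonemptySubsets p)
nonemptySubsets-unique [] = []
nonemptySubsets-unique (false ∷ p) = Unique.map⁺ Vec.∷-injectiveʳ (nonemptySubsets-unique p)
nonemptySubsets-unique (true ∷ p) =
  Unique.++⁺ (Unique.map⁺ Vec.∷-injectiveʳ (nonemptySubsets-unique p))
             (Unique.map⁺ Vec.∷-injectiveʳ (⊥∉ ∷ nonemptySubsets-unique p))
             λ { (q∈ˡ , q∈ʳ) → false≢true q∈ˡ q∈ʳ }
  where
  ⊥∉ : All (⊥ ≢_) (nonemptySubsets p)
  ⊥∉ = All.tabulate λ q∈ ⊥≡q → let x , x∈q = proj₁ (∈-nonemptySubsets⁻ p q∈) in ∉⊥ (≡.subst (x ∈ₛ_) (sym ⊥≡q) x∈q)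
  false≢true : ∀ {q qs rs} → q ∈ map (false ∷_) qs → q ∈ map (true ∷_) rs → False
  false≢true q∈ˡ q∈ʳ with ∈-map⁻ (false ∷_) q∈ˡ | ∈-map⁻ (true ∷_) q∈ʳ
  ... | _ , _ , refl | _ , _ , ()

sumBy-nonemptySubsets : ∀ {n} (p : Subset n) → Nonempty p → sumBy sgn∣∣ (nonemptySubsets p) ≡ -1ℤ
sumBy-nonemptySubsets (false ∷ p) (zero , ())
sumBy-nonemptySubsets (false ∷ p) (suc x , there x∈p) =
  ≡.trans (sumBy-map-false (nonemptySubsets p)) (sumBy-nonemptySubsets p (x , x∈p))
sumBy-nonemptySubsets {ℕ.suc n} (true ∷ p) _ = begin
  sumBy sgn∣∣ (map (false ∷_) qs ++ map (true ∷_) (⊥ ∷ qs))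
    ≡⟨ sumBy-++ sgn∣∣ (map (false ∷_) qs) (map (true ∷_) (⊥ ∷ qs)) ⟩
  sumBy sgn∣∣ (map (false ∷_) qs) + sumBy sgn∣∣ (map (true ∷_) (⊥ ∷ qs))
    ≡⟨ cong₂ _+_ (sumBy-map-false qs) (sumBy-map-true (⊥ ∷ qs)) ⟩
  sumBy sgn∣∣ qs + - (sgn ∣ ⊥ {n = n} ∣ + sumBy sgn∣∣ qs)
    ≡⟨ cong (λ k → sumBy sgn∣∣ qs + - (sgn k + sumBy sgn∣∣ qs)) (∣⊥∣≡0 n) ⟩
  sumBy sgn∣∣ qs + - (1ℤ + sumBy sgn∣∣ qs)
    ≡⟨ cancel (sumBy sgn∣∣ qs) ⟩
  -1ℤ ∎
  where
  open ≡-Reasoning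
  qs : List (Subset n)
  qs = nonemptySubsets p
  cancel : ∀ s → s + - (1ℤ + s) ≡ -1ℤ
  cancel = solve-∀

-- Compositions of ⋃ P and their refinements

module _ {n : ℕ} where

  blockIndex-here : ∀ {p : Subset n} {ps x} → x ∈ₛ p → blockIndex (p ∷ ps) x ≡ 0
  blockIndex-here {p} {x = x} x∈p with x ∈? p
  ... | yes _ = refl
  ... | no x∉p = ⊥-elim (x∉p x∈p)

  blockIndex-there : ∀ {p : Subset n} {ps x} → x ∉ₛ p → blockIndex (p ∷ ps) x ≡ ℕ.suc (blockIndex ps x)
  blockIndex-there {p} {x = x} x∉p with x ∈? p
  ... | yes x∈p = ⊥-elim (x∉p x∈p)
  ... | no _ = refl

  -- A composition of the set ⋃ P, which need not be all of Fin n.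
  WellFormed : List (Subset n) → Set
  WellFormed P = All Nonempty P × AllPairs (λ p q → p ∩ q ≡ ⊥) P

  head-∉⋃tail : ∀ {p ps x} → WellFormed (p ∷ ps) → x ∈ₛ p → x ∉ₛ ⋃ ps
  head-∉⋃tail {ps = ps} (_ , p#ps ∷ _) x∈p x∈⋃ps with x∈⋃⁻ ps x∈⋃ps
  ... | q , q∈ps , x∈q = ∩≡⊥⇒∉ (All.lookup p#ps q∈ps) x∈p x∈q

  ⋃-concat : ∀ {pss : List (List (Subset n))} {P} → Pointwise (λ ps p → ⋃ ps ≡ p) pss P → ⋃ (concat pss) ≡ ⋃ P
  ⋃-concat [] = refl
  ⋃-concat {ps ∷ pss} (⋃ps≡p ∷ pws) = ≡.trans (⋃-++ ps (concat pss)) (cong₂ _∪_ ⋃ps≡p (⋃-concat pws))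

  ⋃-≺ : ∀ {Q P : List (Subset n)} → Q ≺ P → ⋃ Q ≡ ⋃ P
  ⋃-≺ (_ , pws , refl) = ⋃-concat pws

  ≺[]⇒≡[] : ∀ {Q : List (Subset n)} → Q ≺ [] → Q ≡ []
  ≺[]⇒≡[] (_ , [] , refl) = refl

  []≺⇒≡[] : ∀ {P : List (Subset n)} → WellFormed P → [] ≺ P → P ≡ []
  []≺⇒≡[] {[]} _ _ = refl
  []≺⇒≡[] {_ ∷ _} ((y , y∈p) ∷ _ , _) ([] ∷ _ , ⊥≡p ∷ _ , _) = ⊥-elim (∉⊥ (≡.subst (y ∈ₛ_) (sym ⊥≡p) y∈p))

  data Residual (p : Subset n) (ps : List (Subset n)) (b : Subset n) : List (Subset n) → Set where
    shrink : Nonempty (p ─ b) → Residual p ps b ((p ─ b) ∷ ps)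
    vanish : Empty (p ─ b) → Residual p ps b ps

  residual : Subset n → List (Subset n) → Subset n → List (Subset n)
  residual p ps b with nonempty? (p ─ b)
  ... | yes _ = (p ─ b) ∷ ps
  ... | no _ = ps

  residual-view : ∀ p ps b → Residual p ps b (residual p ps b)
  residual-view p ps b with nonempty? (p ─ b)
  ... | yes p─b≢∅ = shrink p─b≢∅
  ... | no p─b≡∅ = vanish p─b≡∅

  module _ {p : Subset n} {ps : List (Subset n)} {b : Subset n} (wf : WellFormed (p ∷ ps)) (b⊆p : b ⊆ p) where

    ∈⋃-residual⁻ : ∀ {R x} → Residual p ps b R → x ∈ₛ ⋃ R → x ∈ₛ ⋃ (p ∷ ps) × x ∉ₛ b
    ∈⋃-residual⁻ {x = x} (shrink _) x∈⋃R with x∈p∪q⁻ (p ─ b) (⋃ ps) x∈⋃R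
    ... | inj₁ x∈p─b = x∈p∪q⁺ (inj₁ (p─q⊆p p b x∈p─b)) , x∈p─q⇒x∉q x∈p─b
    ... | inj₂ x∈⋃ps = x∈p∪q⁺ (inj₂ x∈⋃ps) , λ x∈b → head-∉⋃tail wf (b⊆p x∈b) x∈⋃ps
    ∈⋃-residual⁻ (vanish _) x∈⋃ps = x∈p∪q⁺ (inj₂ x∈⋃ps) , λ x∈b → head-∉⋃tail wf (b⊆p x∈b) x∈⋃ps

    ∈⋃-residual⁺ : ∀ {R x} → Residual p ps b R → x ∈ₛ ⋃ (p ∷ ps) → x ∉ₛ b → x ∈ₛ ⋃ R
    ∈⋃-residual⁺ {x = x} res x∈⋃ x∉b with res | x∈p∪q⁻ p (⋃ ps) x∈⋃
    ... | shrink _ | inj₁ x∈p = x∈p∪q⁺ (inj₁ (x∈p∧x∉q⇒x∈p─q x∈p x∉b))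
    ... | shrink _ | inj₂ x∈⋃ps = x∈p∪q⁺ (inj₂ x∈⋃ps)
    ... | vanish p─b≡∅ | inj₁ x∈p = ⊥-elim (p─b≡∅ (x , x∈p∧x∉q⇒x∈p─q x∈p x∉b))
    ... | vanish _ | inj₂ x∈⋃ps = x∈⋃ps

    residual-wellFormed : ∀ {R} → Residual p ps b R → WellFormed R
    residual-wellFormed res = from res wf
      where
      from : ∀ {R} → Residual p ps b R → WellFormed (p ∷ ps) → WellFormed R
      from (shrink p─b≢∅) (_ ∷ ps≢∅ , p#ps ∷ ps#) =
        p─b≢∅ ∷ ps≢∅ , All.map (λ p∩q≡⊥ → ∉⇒∩≡⊥ (∩≡⊥⇒∉ p∩q≡⊥ ∘ p─q⊆p p b)) p#ps ∷ ps#
      from (vanish _) (_ ∷ ps≢∅ , _ ∷ ps#) = ps≢∅ , ps#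

    blockIndex-residual : ∀ {R} → Residual p ps b R →
      ∃ λ δ → ∀ {x} → x ∈ₛ ⋃ R → blockIndex (p ∷ ps) x ≡ δ ℕ.+ blockIndex R x
    blockIndex-residual res@(shrink _) = 0 , λ {x} x∈⋃R → same-block x∈⋃R (x ∈? p)
      where
      same-block : ∀ {x} → x ∈ₛ ⋃ ((p ─ b) ∷ ps) → Dec (x ∈ₛ p) → blockIndex (p ∷ ps) x ≡ blockIndex ((p ─ b) ∷ ps) x
      same-block x∈⋃R (yes x∈p) =
        ≡.trans (blockIndex-here x∈p) (sym (blockIndex-here (x∈p∧x∉q⇒x∈p─q x∈p (proj₂ (∈⋃-residual⁻ res x∈⋃R)))))
      same-block _ (no x∉p) = ≡.trans (blockIndex-there x∉p) (sym (blockIndex-there (x∉p ∘ p─q⊆p p b)))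
    blockIndex-residual (vanish _) = 1 , λ x∈⋃ps → blockIndex-there (λ x∈p → head-∉⋃tail wf x∈p x∈⋃ps)

    <-residual⁺ : ∀ {R x y} → Residual p ps b R → x ∈ₛ ⋃ R → y ∈ₛ ⋃ R →
      blockIndex R x < blockIndex R y → blockIndex (p ∷ ps) x < blockIndex (p ∷ ps) y
    <-residual⁺ res x∈⋃R y∈⋃R x<y with blockIndex-residual res
    ... | δ , shift rewrite shift x∈⋃R | shift y∈⋃R = ℕ.+-monoʳ-< δ x<y

    <-residual⁻ : ∀ {R x y} → Residual p ps b R → x ∈ₛ ⋃ R → y ∈ₛ ⋃ R →
      blockIndex (p ∷ ps) x < blockIndex (p ∷ ps) y → blockIndex R x < blockIndex R y
    <-residual⁻ res x∈⋃R y∈⋃R x<y with blockIndex-residual res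
    ... | δ , shift rewrite shift x∈⋃R | shift y∈⋃R = ℕ.+-cancelˡ-< δ _ _ x<y

    ∣⋃∣-residual : ∀ {R} → Residual p ps b R → ∣ ⋃ (p ∷ ps) ∣ ≡ ∣ b ∣ ℕ.+ ∣ ⋃ R ∣
    ∣⋃∣-residual {R} res =
      ≡.trans (∣p∣≡∣q∣+∣p─q∣ (⋃ (p ∷ ps)) b (λ x∈b → x∈p∪q⁺ (inj₁ (b⊆p x∈b))))
              (cong (λ r → ∣ b ∣ ℕ.+ ∣ r ∣) (sym ⋃R≡⋃─b))
      where
      ⋃R≡⋃─b : ⋃ R ≡ ⋃ (p ∷ ps) ─ b
      ⋃R≡⋃─b = ⊆-antisym (λ x∈⋃R → let x∈⋃ , x∉b = ∈⋃-residual⁻ res x∈⋃R in x∈p∧x∉q⇒x∈p─q x∈⋃ x∉b)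
                         (λ x∈⋃─b → ∈⋃-residual⁺ res (p─q⊆p _ b x∈⋃─b) (x∈p─q⇒x∉q x∈⋃─b))

  ≺-uncons : ∀ {p ps b Q R} → WellFormed (p ∷ ps) → WellFormed (b ∷ Q) → (b ∷ Q) ≺ (p ∷ ps) →
             Residual p ps b R → b ⊆ p × Q ≺ R
  ≺-uncons ((y , y∈p) ∷ _ , _) _ ([] ∷ _ , ⊥≡p ∷ _ , _) _ = ⊥-elim (∉⊥ (≡.subst (y ∈ₛ_) (sym ⊥≡p) y∈p))
  ≺-uncons {p} {ps} {b} wf (_ ∷ Q≢∅ , b#Q ∷ _) ((.b ∷ qs) ∷ qss , b∪⋃qs≡p ∷ pws , refl) res = b⊆p , refines res
    where
    b⊆p : b ⊆ p
    b⊆p x∈b = ≡.subst (_ ∈ₛ_) b∪⋃qs≡p (x∈p∪q⁺ (inj₁ x∈b))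
    ⋃qs⊆p : ⋃ qs ⊆ p
    ⋃qs⊆p x∈⋃qs = ≡.subst (_ ∈ₛ_) b∪⋃qs≡p (x∈p∪q⁺ (inj₂ x∈⋃qs))
    qs∌b : ∀ {x q} → q ∈ qs → x ∈ₛ q → x ∉ₛ b
    qs∌b q∈qs x∈q x∈b = ∩≡⊥⇒∉ (All.lookup b#Q (∈-++⁺ˡ q∈qs)) x∈b x∈q
    refines : ∀ {R} → Residual p ps b R → (qs ++ concat qss) ≺ R
    refines (shrink _) = qs ∷ qss , ⋃qs≡p─b ∷ pws , refl
      where
      ⋃qs≡p─b : ⋃ qs ≡ p ─ b
      ⋃qs≡p─b = ⊆-antisym
        (λ x∈⋃qs → let _ , q∈qs , x∈q = x∈⋃⁻ qs x∈⋃qs in x∈p∧x∉q⇒x∈p─q (⋃qs⊆p x∈⋃qs) (qs∌b q∈qs x∈q))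
        (λ {x} x∈p─b → [ (λ x∈b → ⊥-elim (x∈p─q⇒x∉q x∈p─b x∈b)) , (λ x∈⋃qs → x∈⋃qs) ]′
                         (x∈p∪q⁻ b (⋃ qs) (≡.subst (x ∈ₛ_) (sym b∪⋃qs≡p) (p─q⊆p p b x∈p─b))))
    refines (vanish p─b≡∅) = refines-ps qs Q≢∅ qs∌b ⋃qs⊆p
      where
      refines-ps : ∀ qs′ → All Nonempty (qs′ ++ concat qss) → (∀ {x q} → q ∈ qs′ → x ∈ₛ q → x ∉ₛ b) →
              ⋃ qs′ ⊆ p → (qs′ ++ concat qss) ≺ ps
      refines-ps [] _ _ _ = qss , pws , refl
      refines-ps (q ∷ _) ((y , y∈q) ∷ _) qs′∌b ⋃qs′⊆p =
        ⊥-elim (p─b≡∅ (y , x∈p∧x∉q⇒x∈p─q (⋃qs′⊆p (x∈p∪q⁺ (inj₁ y∈q))) (qs′∌b (here refl) y∈q)))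

  ≺-cons : ∀ {p ps b Q R} → b ⊆ p → Residual p ps b R → Q ≺ R → (b ∷ Q) ≺ (p ∷ ps)
  ≺-cons {p} {ps} {b} b⊆p (shrink _) (qs ∷ qss , ⋃qs≡p─b ∷ pws , refl) = (b ∷ qs) ∷ qss , b∪⋃qs≡p ∷ pws , refl
    where
    b∪⋃qs≡p : b ∪ ⋃ qs ≡ p
    b∪⋃qs≡p rewrite ⋃qs≡p─b = ⊆-antisym (λ x∈ → [ b⊆p , p─q⊆p p b ]′ (x∈p∪q⁻ b (p ─ b) x∈)) (p⊆q∪[p─q] p b)
  ≺-cons {p} {ps} {b} b⊆p (vanish p─b≡∅) (qss , pws , refl) = (b ∷ []) ∷ qss , b∪⊥≡p ∷ pws , refl
    where
    b∪⊥≡p : b ∪ ⊥ ≡ p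
    b∪⊥≡p = ≡.trans (∪-identityʳ b) (⊆-antisym b⊆p
      (λ x∈p → [ (λ x∈b → x∈b) , (λ x∈p─b → ⊥-elim (p─b≡∅ (_ , x∈p─b))) ]′ (x∈p∪q⁻ b (p ─ b) (p⊆q∪[p─q] p b x∈p))))

-- Refinements compatible with a graph

module _ {n : ℕ} (G : Graph n) where

  -- Walking backwards along predecessors must revisit a vertex within n + 1 steps.
  predecessorClosed⇒cycle : (A : Fin n → Set) → (∀ w → A w → ∃ λ v → A v × (v , w) ∈ G) →
                            ∀ {w} → A w → ∃ λ u → Path⁺ G u u
  predecessorClosed⇒cycle A pred {w} w∈A = cycle (pigeonhole (ℕ.n<1+n n) (f ∘ toℕ))
    where
    chain : ℕ → Σ (Fin n) A
    chain ℕ.zero = w , w∈A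
    chain (ℕ.suc k) = let v , v∈A , _ = pred (proj₁ (chain k)) (proj₂ (chain k)) in v , v∈A
    f : ℕ → Fin n
    f = proj₁ ∘ chain
    step : ∀ k → (f (ℕ.suc k) , f k) ∈ G
    step k = proj₂ (proj₂ (pred (proj₁ (chain k)) (proj₂ (chain k))))
    walk : ∀ {i j} → ℕ.suc i ℕ.≤′ j → Path⁺ G (f j) (f i)
    walk {i} ℕ.≤′-refl = edge (step i)
    walk (ℕ.≤′-step {j} i<j) = edge (step j) ▸ walk i<j
    cycle : (∃₂ λ i j → i Fin.< j × f (toℕ i) ≡ f (toℕ j)) → ∃ λ u → Path⁺ G u u
    cycle (i , j , i<j , fi≡fj) = f (toℕ i) , ≡.subst (λ u → Path⁺ G u (f (toℕ i))) (sym fi≡fj) (walk (ℕ.<⇒<′ i<j))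

  -- C(G, P) for a composition P of ⋃ P; only edges inside ⋃ P are constrained.
  GoodRefinement : List (Subset n) → List (Subset n) → Set
  GoodRefinement P Q = WellFormed Q × Q ≺ P ×
    (∀ {v w} → (v , w) ∈ G → v ∈ₛ ⋃ P → w ∈ₛ ⋃ P → blockIndex Q v < blockIndex Q w)

  NoBackEdge : List (Subset n) → Set
  NoBackEdge P = ∀ {v w} → (v , w) ∈ G → v ∈ₛ ⋃ P → w ∈ₛ ⋃ P → ¬ (blockIndex P w < blockIndex P v)

  ValidHead : Subset n → List (Subset n) → Subset n → Set
  ValidHead p ps b = Nonempty b × b ⊆ p × (∀ {v w} → (v , w) ∈ G → v ∈ₛ ⋃ (p ∷ ps) → w ∉ₛ b)

  good-uncons : ∀ {p ps b Q R} → WellFormed (p ∷ ps) → GoodRefinement (p ∷ ps) (b ∷ Q) →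
                Residual p ps b R → ValidHead p ps b × GoodRefinement R Q
  good-uncons {p} {ps} {b} {Q} {R} wf (wfbQ@(b≢∅ ∷ Q≢∅ , _ ∷ Q#) , bQ≺P , forward) res
    with ≺-uncons wf wfbQ bQ≺P res
  ... | b⊆p , Q≺R = (b≢∅ , b⊆p , no-edge-into-b) , (Q≢∅ , Q#) , Q≺R , forward′
    where
    no-edge-into-b : ∀ {v w} → (v , w) ∈ G → v ∈ₛ ⋃ (p ∷ ps) → w ∉ₛ b
    no-edge-into-b e v∈⋃ w∈b
      with ≡.subst (_ <_) (blockIndex-here {ps = Q} w∈b) (forward e v∈⋃ (x∈p∪q⁺ (inj₁ (b⊆p w∈b))))
    ... | ()
    forward′ : ∀ {v w} → (v , w) ∈ G → v ∈ₛ ⋃ R → w ∈ₛ ⋃ R → blockIndex Q v < blockIndex Q w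
    forward′ e v∈⋃R w∈⋃R with ∈⋃-residual⁻ wf b⊆p res v∈⋃R | ∈⋃-residual⁻ wf b⊆p res w∈⋃R
    ... | v∈⋃ , v∉b | w∈⋃ , w∉b =
      ℕ.≤-pred (≡.subst₂ _<_ (blockIndex-there {ps = Q} v∉b) (blockIndex-there {ps = Q} w∉b) (forward e v∈⋃ w∈⋃))

  good-cons : ∀ {p ps b Q R} → WellFormed (p ∷ ps) → ValidHead p ps b → Residual p ps b R →
              GoodRefinement R Q → GoodRefinement (p ∷ ps) (b ∷ Q)
  good-cons {p} {ps} {b} {Q} wf (b≢∅ , b⊆p , no-edge-into-b) res ((Q≢∅ , Q#) , Q≺R , forward) =
    (b≢∅ ∷ Q≢∅ , All.tabulate b#q ∷ Q#) , ≺-cons b⊆p res Q≺R , forward′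
    where
    b#q : ∀ {q} → q ∈ Q → b ∩ q ≡ ⊥
    b#q q∈Q = ∉⇒∩≡⊥ λ x∈b x∈q →
      proj₂ (∈⋃-residual⁻ wf b⊆p res (≡.subst (_ ∈ₛ_) (⋃-≺ Q≺R) (x∈⋃⁺ q∈Q x∈q))) x∈b
    forward′ : ∀ {v w} → (v , w) ∈ G → v ∈ₛ ⋃ (p ∷ ps) → w ∈ₛ ⋃ (p ∷ ps) → blockIndex (b ∷ Q) v < blockIndex (b ∷ Q) w
    forward′ {v} {w} e v∈⋃ w∈⋃ = ordered (v ∈? b)
      where
      w∉b : w ∉ₛ b
      w∉b = no-edge-into-b e v∈⋃
      ordered : Dec (v ∈ₛ b) → blockIndex (b ∷ Q) v < blockIndex (b ∷ Q) w
      ordered (yes v∈b) = ≡.subst₂ _<_ (sym (blockIndex-here v∈b)) (sym (blockIndex-there w∉b)) (ℕ.s≤s ℕ.z≤n)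
      ordered (no v∉b) = ≡.subst₂ _<_ (sym (blockIndex-there v∉b)) (sym (blockIndex-there w∉b))
        (ℕ.s≤s (forward e (∈⋃-residual⁺ wf b⊆p res v∈⋃ v∉b) (∈⋃-residual⁺ wf b⊆p res w∈⋃ w∉b)))

  noBackEdge-residual : ∀ {p ps b R} → WellFormed (p ∷ ps) → b ⊆ p → Residual p ps b R →
                        NoBackEdge (p ∷ ps) → NoBackEdge R
  noBackEdge-residual wf b⊆p res noBack e v∈⋃R w∈⋃R w<v =
    noBack e (proj₁ (∈⋃-residual⁻ wf b⊆p res v∈⋃R)) (proj₁ (∈⋃-residual⁻ wf b⊆p res w∈⋃R))
             (<-residual⁺ wf b⊆p res w∈⋃R v∈⋃R w<v)

  good⇒noBackEdge : ∀ {P Q} → WellFormed P → GoodRefinement P Q → NoBackEdge P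
  good⇒noBackEdge {Q = []} wf (_ , []≺P , _) with []≺⇒≡[] wf []≺P
  ... | refl = λ _ v∈⊥ _ _ → ∉⊥ v∈⊥
  good⇒noBackEdge {[]} {_ ∷ _} _ (_ , Q≺[] , _) with ≺[]⇒≡[] Q≺[]
  ... | ()
  good⇒noBackEdge {p ∷ ps} {b ∷ Q} wf good {v} {w} e v∈⋃ w∈⋃ w<v = ordered (w ∈? b) (v ∈? b)
    where
    res : Residual p ps b (residual p ps b)
    res = residual-view p ps b
    head-valid : ValidHead p ps b
    head-valid = proj₁ (good-uncons wf good res)
    b⊆p : b ⊆ p
    b⊆p = proj₁ (proj₂ head-valid)
    ordered : Dec (w ∈ₛ b) → Dec (v ∈ₛ b) → False
    ordered (yes w∈b) _ = proj₂ (proj₂ head-valid) e v∈⋃ w∈b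
    ordered (no _) (yes v∈b) with ≡.subst (_ <_) (blockIndex-here {ps = ps} (b⊆p v∈b)) w<v
    ... | ()
    ordered (no w∉b) (no v∉b) =
      good⇒noBackEdge (residual-wellFormed wf b⊆p res) (proj₂ (good-uncons wf good res)) e v∈⋃R w∈⋃R
        (<-residual⁻ wf b⊆p res w∈⋃R v∈⋃R w<v)
      where
      v∈⋃R : v ∈ₛ ⋃ (residual p ps b)
      v∈⋃R = ∈⋃-residual⁺ wf b⊆p res v∈⋃ v∉b
      w∈⋃R : w ∈ₛ ⋃ (residual p ps b)
      w∈⋃R = ∈⋃-residual⁺ wf b⊆p res w∈⋃ w∉b

  open import Data.List.Membership.DecPropositional {A = Fin n × Fin n} (≡-dec _≟ᶠ_ _≟ᶠ_)
    using () renaming (_∈?_ to _∈ᴳ?_)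

  HasPredecessorIn : Subset n → Fin n → Set
  HasPredecessorIn s w = ∃ λ v → v ∈ₛ s × (v , w) ∈ G

  hasPredecessorIn? : ∀ s w → Dec (HasPredecessorIn s w)
  hasPredecessorIn? s w = any? λ v → (v ∈? s) ×-dec ((v , w) ∈ᴳ? G)

  IsSource : Subset n → List (Subset n) → Fin n → Set
  IsSource p ps w = w ∈ₛ p × ¬ HasPredecessorIn (⋃ (p ∷ ps)) w

  isSource? : ∀ p ps w → Dec (IsSource p ps w)
  isSource? p ps w = (w ∈? p) ×-dec ¬? (hasPredecessorIn? (⋃ (p ∷ ps)) w)

  sources : Subset n → List (Subset n) → Subset n
  sources p ps = tabulate (isYes ∘ isSource? p ps)

  ∈-sources : ∀ p ps {w} → w ∈ₛ sources p ps ⇔ IsSource p ps w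
  ∈-sources p ps {w} = mk⇔
    (λ w∈ → toWitness (Equivalence.from T-≡ (≡.trans (sym (Vec.lookup∘tabulate _ w)) (Vec.[]=⇒lookup w∈))))
    (λ source → Vec.lookup⇒[]= w _ (≡.trans (Vec.lookup∘tabulate _ w) (Equivalence.to T-≡ (fromWitness source))))

  validHead⇔∈nonemptySubsets : ∀ p ps {b} → ValidHead p ps b ⇔ b ∈ nonemptySubsets (sources p ps)
  validHead⇔∈nonemptySubsets p ps {b} = mk⇔
    (λ (b≢∅ , b⊆p , no-edge-into-b) → ∈-nonemptySubsets⁺ _ b b≢∅
       λ {w} w∈b → Equivalence.from (∈-sources p ps) (b⊆p w∈b , λ (_ , v∈⋃ , e) → no-edge-into-b e v∈⋃ w∈b))
    (λ b∈ → let b≢∅ , b⊆sources = ∈-nonemptySubsets⁻ _ b∈ in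
       b≢∅ , (λ {w} w∈b → proj₁ (Equivalence.to (∈-sources p ps) (b⊆sources w∈b))) ,
       λ {v} {w} e v∈⋃ w∈b → proj₂ (Equivalence.to (∈-sources p ps) (b⊆sources w∈b)) (v , v∈⋃ , e))

  -- Without sources every element of p has a predecessor, which lies in p again since P has no back edge.
  sources-nonempty : ∀ {p ps} → Acyclic G → WellFormed (p ∷ ps) → NoBackEdge (p ∷ ps) → Nonempty (sources p ps)
  sources-nonempty {p} {ps} acyclic ((w , w∈p) ∷ _ , _) noBack with any? (isSource? p ps)
  ... | yes (s , source) = s , Equivalence.from (∈-sources p ps) source
  ... | no no-source = ⊥-elim (acyclic (proj₁ cycle) (proj₂ cycle))
    where
    predecessor : ∀ x → x ∈ₛ p → ∃ λ v → v ∈ₛ p × (v , x) ∈ G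
    predecessor x x∈p with hasPredecessorIn? (⋃ (p ∷ ps)) x
    ... | no none = ⊥-elim (no-source (x , x∈p , none))
    ... | yes (v , v∈⋃ , e) with v ∈? p
    ...   | yes v∈p = v , v∈p , e
    ...   | no v∉p = ⊥-elim (noBack e v∈⋃ (x∈p∪q⁺ (inj₁ x∈p))
                       (≡.subst₂ _<_ (sym (blockIndex-here x∈p)) (sym (blockIndex-there v∉p)) (ℕ.s≤s ℕ.z≤n)))
    cycle : ∃ λ u → Path⁺ G u u
    cycle = predecessorClosed⇒cycle (_∈ₛ p) predecessor w∈p

  GoodCons : Subset n → List (Subset n) → List (Subset n) → Set
  GoodCons p ps = ConsOf (nonemptySubsets (sources p ps)) (GoodRefinement ∘ residual p ps)

  goodCons⇔good : ∀ {p ps} → WellFormed (p ∷ ps) → ∀ Q → GoodCons p ps Q ⇔ GoodRefinement (p ∷ ps) Q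
  goodCons⇔good {p} {ps} wf Q = mk⇔ to from
    where
    to : ∀ {Q} → GoodCons p ps Q → GoodRefinement (p ∷ ps) Q
    to (b , _ , refl , b∈ , good) =
      good-cons wf (Equivalence.from (validHead⇔∈nonemptySubsets p ps) b∈) (residual-view p ps b) good
    from : ∀ {Q} → GoodRefinement (p ∷ ps) Q → GoodCons p ps Q
    from {[]} (_ , []≺P , _) with []≺⇒≡[] wf []≺P
    ... | ()
    from {b ∷ Q} good with good-uncons wf good (residual-view p ps b)
    ... | valid , good′ = b , Q , refl , Equivalence.to (validHead⇔∈nonemptySubsets p ps) valid , good′

  GoodEnumeration : List (Subset n) → Set
  GoodEnumeration P = Σ (List (List (Subset n))) λ L → Enumerates L (GoodRefinement P) × signedCount L ≡ sgn ∣ ⋃ P ∣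

  module _ (acyclic : Acyclic G) where

    goodEnumeration-cons : ∀ {p ps} → WellFormed (p ∷ ps) → NoBackEdge (p ∷ ps) →
      (∀ {b} → b ∈ nonemptySubsets (sources p ps) → GoodEnumeration (residual p ps b)) → GoodEnumeration (p ∷ ps)
    goodEnumeration-cons {p} {ps} wf noBack enumerateResidual =
      conclude (enumerate-ConsOf (GoodRefinement ∘ residual p ps) (λ b → sgn ∣ b ∣ * sgn N)
                  (nonemptySubsets-unique (sources p ps)) (All.tabulate weighted))
      where
      open ≡-Reasoning
      N : ℕ
      N = ∣ ⋃ (p ∷ ps) ∣
      heads : List (Subset n)
      heads = nonemptySubsets (sources p ps)
      weighted : ∀ {b} → b ∈ heads → Σ (List (List (Subset n))) λ L →
        Enumerates L (GoodRefinement (residual p ps b)) × signedCount L ≡ sgn ∣ b ∣ * sgn N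
      weighted {b} b∈ with enumerateResidual b∈
      ... | L , enumerates , ΣL = L , enumerates , ≡.trans ΣL (sym (begin
        sgn ∣ b ∣ * sgn N
          ≡⟨ cong (λ k → sgn ∣ b ∣ * sgn k) (∣⋃∣-residual wf b⊆p (residual-view p ps b)) ⟩
        sgn ∣ b ∣ * sgn (∣ b ∣ ℕ.+ ∣ ⋃ (residual p ps b) ∣)
          ≡⟨ sgn-+-cancel ∣ b ∣ _ ⟩
        sgn ∣ ⋃ (residual p ps b) ∣
          ∎))
        where
        b⊆p : b ⊆ p
        b⊆p = proj₁ (proj₂ (Equivalence.from (validHead⇔∈nonemptySubsets p ps) b∈))
      conclude : (Σ (List (List (Subset n))) λ L → Enumerates L (GoodCons p ps) ×
                   signedCount L ≡ sumBy (λ b → - (sgn ∣ b ∣ * sgn N)) heads) → GoodEnumeration (p ∷ ps)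
      conclude (L , enumerates , ΣL) = L , enumerates-⇔ enumerates (goodCons⇔good wf) , (begin
        signedCount L                                    ≡⟨ ΣL ⟩
        sumBy (λ b → - (sgn ∣ b ∣ * sgn N)) heads        ≡⟨ sumBy-neg-*ʳ sgn∣∣ (sgn N) heads ⟩
        - (sumBy sgn∣∣ heads * sgn N)
          ≡⟨ cong (λ s → - (s * sgn N)) (sumBy-nonemptySubsets _ (sources-nonempty acyclic wf noBack)) ⟩
        - (-1ℤ * sgn N)                                  ≡⟨ cong -_ (ℤ.-1*i≡-i (sgn N)) ⟩
        - - sgn N                                        ≡⟨ ℤ.neg-involutive (sgn N) ⟩
        sgn N                                            ∎)

    goodEnumeration : ∀ k P → ∣ ⋃ P ∣ ℕ.≤ k → WellFormed P → NoBackEdge P → GoodEnumeration P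
    goodEnumeration _ [] _ _ _ = [] ∷ [] , ([] ∷ [] , λ Q → mk⇔ to from) , cong sgn (sym (∣⊥∣≡0 n))
      where
      to : ∀ {Q} → Q ∈ [] ∷ [] → GoodRefinement [] Q
      to (here refl) = ([] , []) , ([] , [] , refl) , λ _ v∈⊥ _ → ⊥-elim (∉⊥ v∈⊥)
      from : ∀ {Q} → GoodRefinement [] Q → Q ∈ [] ∷ []
      from (_ , Q≺[] , _) rewrite ≺[]⇒≡[] Q≺[] = here refl
    goodEnumeration ℕ.zero (p ∷ ps) ∣⋃∣≤0 ((x , x∈p) ∷ _ , _) _
      with ℕ.≤-trans (Nonempty⇒∣p∣>0 (x , x∈p∪q⁺ {p = p} {q = ⋃ ps} (inj₁ x∈p))) ∣⋃∣≤0
    ... | ()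
    goodEnumeration (ℕ.suc k) (p ∷ ps) ∣⋃∣≤1+k wf noBack = goodEnumeration-cons wf noBack enumerateResidual
      where
      enumerateResidual : ∀ {b} → b ∈ nonemptySubsets (sources p ps) → GoodEnumeration (residual p ps b)
      enumerateResidual {b} b∈ =
        goodEnumeration k (residual p ps b) ∣⋃R∣≤k (residual-wellFormed wf b⊆p res)
          (noBackEdge-residual wf b⊆p res noBack)
        where
        res : Residual p ps b (residual p ps b)
        res = residual-view p ps b
        b≢∅ : Nonempty b
        b≢∅ = proj₁ (Equivalence.from (validHead⇔∈nonemptySubsets p ps) b∈)
        b⊆p : b ⊆ p
        b⊆p = proj₁ (proj₂ (Equivalence.from (validHead⇔∈nonemptySubsets p ps) b∈))
        ∣⋃R∣≤k : ∣ ⋃ (residual p ps b) ∣ ℕ.≤ k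
        ∣⋃R∣≤k = ℕ.≤-pred (ℕ.≤-trans (ℕ.+-monoˡ-≤ _ (Nonempty⇒∣p∣>0 b≢∅))
                                     (≡.subst (ℕ._≤ ℕ.suc k) (∣⋃∣-residual wf b⊆p res) ∣⋃∣≤1+k))

inC⇔good : ∀ {n} (G : Graph n) {P} → ⋃ P ≡ ⊤ → ∀ Q → InC G P Q ⇔ GoodRefinement G P Q
inC⇔good G {P} ⋃P≡⊤ Q = mk⇔
  (λ ((Q≢∅ , Q# , _) , Q≺P , forward) → (Q≢∅ , Q#) , Q≺P , λ e _ _ → forward e)
  (λ ((Q≢∅ , Q#) , Q≺P , forward) → (Q≢∅ , Q# , ≡.trans (⋃-≺ Q≺P) ⋃P≡⊤) , Q≺P , λ e → forward e ∈⋃P ∈⋃P)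
  where
  ∈⋃P : ∀ {x} → x ∈ₛ ⋃ P
  ∈⋃P = ≡.subst (_ ∈ₛ_) (sym ⋃P≡⊤) ∈⊤

inC[]⇔ : ∀ {n} {P Q : List (Subset n)} → InC [] P Q ⇔ (IsComposition Q × Q ≺ P)
inC[]⇔ = mk⇔ (λ (composition , Q≺P , _) → composition , Q≺P) (λ (composition , Q≺P) → composition , Q≺P , λ ())

no-path-in-[] : ∀ {n} {u v : Fin n} → ¬ Path⁺ [] u v
no-path-in-[] (edge ())
no-path-in-[] (p ▸ _) = no-path-in-[] p

BackEdge : ∀ {n} → Graph n → List (Subset n) → Set
BackEdge {n} G P = Σ (Fin n × Fin n) λ e → e ∈ G × blockIndex P (proj₂ e) < blockIndex P (proj₁ e)

module _ {n} {G : Graph n} {P : List (Subset n)} (composition : IsComposition P)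
         {L} (enumerates : Enumerates L (InC G P)) where

  private
    wf : WellFormed P
    wf = proj₁ composition , proj₁ (proj₂ composition)
    ⋃P≡⊤ : ⋃ P ≡ ⊤
    ⋃P≡⊤ = proj₂ (proj₂ composition)
    enumeratesGood : Enumerates L (GoodRefinement G P)
    enumeratesGood = enumerates-⇔ enumerates (inC⇔good G ⋃P≡⊤)
    ∈⋃P : ∀ {x} → x ∈ₛ ⋃ P
    ∈⋃P = ≡.subst (_ ∈ₛ_) (sym ⋃P≡⊤) ∈⊤

  signedSum-backEdge : BackEdge G P → signedSum L ≡ 0ℤ
  signedSum-backEdge (_ , e , w<v)
    rewrite enumerates-∅ enumeratesGood (λ Q good → good⇒noBackEdge G wf good e ∈⋃P ∈⋃P w<v) = refl

  signedSum-noBackEdge : Acyclic G → ¬ BackEdge G P → signedSum L ≡ sgn n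
  signedSum-noBackEdge acyclic ∄back
    with goodEnumeration G acyclic _ P ℕ.≤-refl wf (λ e _ _ w<v → ∄back (_ , e , w<v))
  ... | L′ , enumerates′ , ΣL′ = begin
    signedSum L        ≡⟨ sumBy-enumerates (sgn ∘ length) enumeratesGood enumerates′ ⟩
    signedSum L′       ≡⟨ ΣL′ ⟩
    sgn ∣ ⋃ P ∣        ≡⟨ cong sgn (≡.trans (cong ∣_∣ ⋃P≡⊤) (∣⊤∣≡n n)) ⟩
    sgn n              ∎
    where open ≡-Reasoning

mainTheorem5 :
    ∀ (n : ℕ) (P : List (Subset n)) → IsComposition P →
    -- first claim: L enumerates { Q : Q ≺ P } without repetition
    (∀ (L : List (List (Subset n))) → Unique L →
       (∀ Q → (Q ∈ L) ⇔ (IsComposition Q × Q ≺ P)) →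
       signedSum L ≡ sgn n)
    ×
    -- general claim: G a DAG, L enumerates C(G,P) without repetition
    (∀ (G : Graph n) → Acyclic G →
     ∀ (L : List (List (Subset n))) → Unique L →
       (∀ Q → (Q ∈ L) ⇔ InC G P Q) →
       ((Σ (Fin n × Fin n) λ e → e ∈ G × blockIndex P (proj₂ e) < blockIndex P (proj₁ e)) → signedSum L ≡ 0ℤ)
       × (¬ (Σ (Fin n × Fin n) λ e → e ∈ G × blockIndex P (proj₂ e) < blockIndex P (proj₁ e)) → signedSum L ≡ sgn n))
mainTheorem5 n P composition = refinements , λ G acyclic L unique L⇔C →
    signedSum-backEdge composition (unique , L⇔C) , signedSum-noBackEdge composition (unique , L⇔C) acyclic
  where
  refinements : ∀ L → Unique L → (∀ Q → (Q ∈ L) ⇔ (IsComposition Q × Q ≺ P)) → signedSum L ≡ sgn n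
  refinements L unique L⇔ = signedSum-noBackEdge composition (unique , λ Q → ⇔.trans (L⇔ Q) (⇔.sym inC[]⇔))
    (λ _ → no-path-in-[]) λ { (_ , () , _) }
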